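{- Let $k\geq 1$, $n\geq 1$, and let $u,v\in\Sigma_k^n$. Let $i=\operatorname{lso}(u,v)$ and $j=\operatorname{lso}(v,u)$. Then $i+j\leq n$ if and only if $u=xsy$ and $v=ytx$ for some words $s,t\in\Sigma_k^*$, $x\in\mathcal{U}_j^k$ and $y\in\mathcal{U}_i^k$.
   Context: $\Sigma_k=\{0,1,\ldots,k-1\}$, $\Sigma_k^n$ is the set of length-$n$ words over $\Sigma_k$ and $\Sigma_k^*$ the set of all finite words. A border of a word $w$ is a non-empty word that is both a proper prefix and a proper suffix of $w$; $w$ is unbordered if it has no border (in particular the empty word and all length-1 words are unbordered). $\mathcal{U}_m^k$ denotes the set of unbordered words of length $m$ over $\Sigma_k$. A right-border of the pair $(u,v)$ is a non-empty word that is a proper suffix of $u$ and a proper prefix of $v$. $\operatorname{lso}(u,v)$ is the length of the shortest right-border of $(u,v)$, and $\operatorname{lso}(u,v)=0$ if $(u,v)$ has no right-border. Thus $\operatorname{lso}(v,u)$ is the length of the shortest non-empty word that is a proper prefix of $u$ and a proper suffix of $v$ (or $0$ if none exists). -}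

module Defs where

open import Data.Nat using (ℕ; zero; suc; _<_; _≤_)
open import Data.Fin using (Fin)
open import Data.List using (List; []; _∷_; _++_; length)
open import Data.Product using (Σ; ∃; _×_; _,_)
open import Data.Sum using (_⊎_)
open import Relation.Nullary using (¬_)
open import Relation.Binary.PropositionalEquality using (_≡_)

Word : ℕ → Set
Word k = List (Fin k)

IsPrefix : ∀ {k} → Word k → Word k → Set
IsPrefix {k} p w = Σ (Word k) λ r → w ≡ p ++ r

IsSuffix : ∀ {k} → Word k → Word k → Set
IsSuffix {k} s w = Σ (Word k) λ r → w ≡ r ++ s

IsProperPrefix : ∀ {k} → Word k → Word k → Set
IsProperPrefix p w = IsPrefix p w × length p < length w

IsProperSuffix : ∀ {k} → Word k → Word k → Set
IsProperSuffix s w = IsSuffix s w × length s < length w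

NonEmpty : ∀ {k} → Word k → Set
NonEmpty w = 0 < length w

IsBorder : ∀ {k} → Word k → Word k → Set
IsBorder b w = NonEmpty b × IsProperPrefix b w × IsProperSuffix b w

Unbordered : ∀ {k} → Word k → Set
Unbordered {k} w = (b : Word k) → ¬ IsBorder b w

IsUnbordered : ∀ {k} → ℕ → Word k → Set
IsUnbordered m w = length w ≡ m × Unbordered w

IsRightBorder : ∀ {k} → Word k → Word k → Word k → Set
IsRightBorder b u v = NonEmpty b × IsProperSuffix b u × IsProperPrefix b v

Lso : ∀ {k} → Word k → Word k → ℕ → Set
Lso {k} u v i =
    (Σ (Word k) λ b → IsRightBorder b u v × length b ≡ i
       × ((b' : Word k) → IsRightBorder b' u v → i ≤ length b'))
  ⊎ (((b : Word k) → ¬ IsRightBorder b u v) × i ≡ 0)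

module Submission where

-- Let y be the shortest right-border of (u, v) and x the shortest right-border of
-- (v, u), taking the empty word when there is none. Minimality makes them unbordered,
-- since a border of y would be a shorter right-border. Now y is a suffix and x a
-- prefix of u; they fit side by side in u exactly when |x| + |y| ≤ |u|, and likewise
-- in v, which yields the factorisations u = x s y and v = y t x.

open import Level using (Level)
open import Defs
open import Data.Nat using (ℕ; _+_; _≤_; _≥_; s≤s)
open import Data.Nat.Properties
  using (+-comm; +-cancelʳ-≤; m≤m+n; +-monoʳ-≤; ≤-<-trans; <-trans; <-irrefl; module ≤-Reasoning)
open import Data.List using (List; []; _∷_; _++_; length)
open import Data.List.Properties using (length-++; ++-assoc; ++-identityʳ; ∷-injective)
open import Data.Product using (Σ; ∃; _×_; _,_)
open import Data.Sum using (inj₁; inj₂)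
open import Function.Bundles using (_⇔_; mk⇔)
open import Relation.Binary.PropositionalEquality
  using (_≡_; refl; sym; trans; cong; cong₂; subst)

private
  variable
    a : Level
    A : Set a

++-prefix-extends : (xs ys zs ws : List A) → xs ++ ys ≡ zs ++ ws →
                    length xs ≤ length zs → ∃ λ ms → zs ≡ xs ++ ms
++-prefix-extends []       ys zs       ws eq le       = zs , refl
++-prefix-extends (x ∷ xs) ys (z ∷ zs) ws eq (s≤s le) with ∷-injective eq
... | refl , eq′ with ++-prefix-extends xs ys zs ws eq′ le
...   | ms , refl = ms , refl

length-outer-≤ : (xs ys zs : List A) → length xs + length zs ≤ length (xs ++ ys ++ zs)
length-outer-≤ xs ys zs = begin
  length xs + length zs                ≤⟨ +-monoʳ-≤ (length xs) (m≤m+n (length zs) (length ys)) ⟩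
  length xs + (length zs + length ys)  ≡⟨ cong (length xs +_) (+-comm (length zs) (length ys)) ⟩
  length xs + (length ys + length zs)  ≡⟨ cong (length xs +_) (length-++ ys) ⟨
  length xs + length (ys ++ zs)        ≡⟨ length-++ xs ⟨
  length (xs ++ ys ++ zs)              ∎
  where open ≤-Reasoning

prefix-suffix-disjoint : (w p q xs ys : List A) → w ≡ p ++ ys → w ≡ xs ++ q →
                         length xs + length ys ≤ length w → ∃ λ s → w ≡ xs ++ s ++ ys
prefix-suffix-disjoint w p q xs ys w≡pys w≡xsq le
  with ++-prefix-extends xs q p ys (trans (sym w≡xsq) w≡pys) |xs|≤|p|
  where
  |xs|≤|p| : length xs ≤ length p
  |xs|≤|p| = +-cancelʳ-≤ (length ys) (length xs) (length p)
    (subst (length xs + length ys ≤_) (trans (cong length w≡pys) (length-++ p)) le)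
... | s , refl = s , trans w≡pys (++-assoc xs s ys)

[]-unbordered : ∀ {k} → IsUnbordered {k} 0 []
[]-unbordered = refl , λ { _ (_ , (_ , ()) , _) }

border-rightBorder : ∀ {k} {c b u v : Word k} → IsBorder c b → IsRightBorder b u v →
                     IsRightBorder c u v
border-rightBorder (c≢[] , ((r , b≡cr) , c<b) , ((r′ , b≡r′c) , _))
                   (_ , ((ru , u≡rub) , b<u) , ((rv , v≡brv) , b<v))
  = c≢[]
  , ((ru ++ r′ , trans u≡rub (trans (cong (ru ++_) b≡r′c) (sym (++-assoc ru r′ _))))
    , <-trans c<b b<u)
  , ((r ++ rv , trans v≡brv (trans (cong (_++ rv) b≡cr) (++-assoc _ r rv)))
    , <-trans c<b b<v)

shortest-rightBorder-unbordered : ∀ {k} {b u v : Word k} → IsRightBorder b u v →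
  ((b′ : Word k) → IsRightBorder b′ u v → length b ≤ length b′) → Unbordered b
shortest-rightBorder-unbordered rb shortest c c-border@(_ , (_ , c<b) , _) =
  <-irrefl refl (≤-<-trans (shortest c (border-rightBorder c-border rb)) c<b)

lso-overlap : ∀ {k} {u v : Word k} {i : ℕ} → Lso u v i →
              Σ (Word k) λ y → IsUnbordered i y × IsSuffix y u × IsPrefix y v
lso-overlap (inj₁ (y , rb@(_ , (y-suffix , _) , (y-prefix , _)) , refl , shortest)) =
  y , (refl , shortest-rightBorder-unbordered rb shortest) , y-suffix , y-prefix
lso-overlap {u = u} {v} (inj₂ (_ , refl)) =
  [] , []-unbordered , (u , sym (++-identityʳ u)) , (v , refl)

lemma4 : (k n : ℕ) → k ≥ 1 → n ≥ 1 → (u v : Word k) → length u ≡ n → length v ≡ n →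
         (i j : ℕ) → Lso u v i → Lso v u j →
         (i + j ≤ n) ⇔
           (Σ (Word k) λ s → Σ (Word k) λ t → Σ (Word k) λ x → Σ (Word k) λ y →
              IsUnbordered j x × IsUnbordered i y ×
              u ≡ x ++ s ++ y × v ≡ y ++ t ++ x)
lemma4 k n _ _ u v |u|≡n |v|≡n i j lso-uv lso-vu = mk⇔ factorise lengths
  where
  open ≤-Reasoning

  Factorisation : Set
  Factorisation = Σ (Word k) λ s → Σ (Word k) λ t → Σ (Word k) λ x → Σ (Word k) λ y →
                    IsUnbordered j x × IsUnbordered i y × u ≡ x ++ s ++ y × v ≡ y ++ t ++ x

  factorise : i + j ≤ n → Factorisation
  factorise i+j≤n
    with lso-overlap lso-uv | lso-overlap lso-vu
  ... | y , y-unb@(|y|≡i , _) , (ru , u≡ruy) , (rv , v≡yrv)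
      | x , x-unb@(|x|≡j , _) , (rv′ , v≡rv′x) , (ru′ , u≡xru′)
    with prefix-suffix-disjoint u ru ru′ x y u≡ruy u≡xru′ (begin
           length x + length y  ≡⟨ cong₂ _+_ |x|≡j |y|≡i ⟩
           j + i                ≡⟨ +-comm j i ⟩
           i + j                ≤⟨ i+j≤n ⟩
           n                    ≡⟨ |u|≡n ⟨
           length u             ∎)
       | prefix-suffix-disjoint v rv′ rv y x v≡rv′x v≡yrv (begin
           length y + length x  ≡⟨ cong₂ _+_ |y|≡i |x|≡j ⟩
           i + j                ≤⟨ i+j≤n ⟩
           n                    ≡⟨ |v|≡n ⟨
           length v             ∎)
  ...  | s , u≡xsy | t , v≡ytx = s , t , x , y , x-unb , y-unb , u≡xsy , v≡ytx

  lengths : Factorisation → i + j ≤ n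
  lengths (s , _ , x , y , (|x|≡j , _) , (|y|≡i , _) , u≡xsy , _) = begin
    i + j                 ≡⟨ +-comm i j ⟩
    j + i                 ≡⟨ cong₂ _+_ |x|≡j |y|≡i ⟨
    length x + length y   ≤⟨ length-outer-≤ x s y ⟩
    length (x ++ s ++ y)  ≡⟨ cong length u≡xsy ⟨
    length u              ≡⟨ |u|≡n ⟩
    n                     ∎
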